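{- Let $G$ be a group and suppose the definable Fitting subgroup $dF(G)$ coincides with a nilpotent subgroup $\phi(G,\overline{a})$ definable by a formula $\phi(x,\overline{y})$ of the language of groups with parameters $\overline{a}$ from $G$. Then $dF(G)$ is $\emptyset$-definable in $\mathrm{Th}(G)$, i.e. definable by a formula of the language of groups without parameters.
   Context: The definable Fitting subgroup $dF(G)$ of a group $G$ is the subgroup generated by all normal nilpotent subgroups of $G$ that are definable (in the language of groups, with parameters from $G$). $\mathrm{Th}(G)$ is the complete first-order theory of $G$ in the language of groups. -}

module Defs where

open import Level using (Level; _⊔_; Lift)
open import Data.Nat using (ℕ; zero; suc)
open import Data.Fin using (Fin)
open import Data.Product using (Σ; _×_)
open import Data.Sum using (_⊎_)
open import Data.Empty.Polymorphic using (⊥)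
open import Data.Vec.Functional using (Vector; _∷_)
open import Relation.Unary using (Pred; _∈_)
open import Algebra.Bundles using (Group)

data Term (n : ℕ) : Set where
  var  : Fin n → Term n
  one  : Term n
  _·_  : Term n → Term n → Term n
  inv  : Term n → Term n

data Formula (n : ℕ) : Set where
  _≐_  : Term n → Term n → Formula n
  ⊥̇    : Formula n
  _∧̇_  : Formula n → Formula n → Formula n
  _∨̇_  : Formula n → Formula n → Formula n
  _⇒̇_  : Formula n → Formula n → Formula n
  ¬̇_   : Formula n → Formula n
  ∀̇    : Formula (suc n) → Formula n
  ∃̇    : Formula (suc n) → Formula n

module GroupTheory {c ℓ : Level} (G : Group c ℓ) where
  open Group G

  L : Level
  L = c ⊔ ℓ

  ⟦_⟧ₜ : ∀ {n} → Term n → Vector Carrier n → Carrier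
  ⟦ var i ⟧ₜ ρ = ρ i
  ⟦ one   ⟧ₜ ρ = ε
  ⟦ s · t ⟧ₜ ρ = ⟦ s ⟧ₜ ρ ∙ ⟦ t ⟧ₜ ρ
  ⟦ inv t ⟧ₜ ρ = ⟦ t ⟧ₜ ρ ⁻¹

  _⊨_ : ∀ {n} → Vector Carrier n → Formula n → Set L
  ρ ⊨ (s ≐ t) = Lift c (⟦ s ⟧ₜ ρ ≈ ⟦ t ⟧ₜ ρ)
  ρ ⊨ ⊥̇       = ⊥ {L}
  ρ ⊨ (φ ∧̇ ψ) = (ρ ⊨ φ) × (ρ ⊨ ψ)
  ρ ⊨ (φ ∨̇ ψ) = (ρ ⊨ φ) ⊎ (ρ ⊨ ψ)
  ρ ⊨ (φ ⇒̇ ψ) = (ρ ⊨ φ) → (ρ ⊨ ψ)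
  ρ ⊨ (¬̇ φ)   = (ρ ⊨ φ) → ⊥ {L}
  ρ ⊨ ∀̇ φ     = (x : Carrier) → (x ∷ ρ) ⊨ φ
  ρ ⊨ ∃̇ φ     = Σ Carrier λ x → (x ∷ ρ) ⊨ φ

  -- φ(G, ā) = { x ∈ G | G ⊨ φ(x, ā) }  for φ(x, ȳ) with |ȳ| = m
  defSet : ∀ {m} → Formula (suc m) → Vector Carrier m → Pred Carrier L
  defSet φ a x = (x ∷ a) ⊨ φ

  record IsSubgroup (S : Pred Carrier L) : Set L where
    field
      resp  : ∀ {x y} → x ≈ y → x ∈ S → y ∈ S
      ε∈    : ε ∈ S
      ∙-closed : ∀ {x y} → x ∈ S → y ∈ S → (x ∙ y) ∈ S
      ⁻¹-closed : ∀ {x} → x ∈ S → (x ⁻¹) ∈ S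

  IsNormal : Pred Carrier L → Set L
  IsNormal S = ∀ g {h} → h ∈ S → (g ∙ h ∙ g ⁻¹) ∈ S

  data ⟨_⟩ (S : Pred Carrier L) : Pred Carrier L where
    base : ∀ {x} → x ∈ S → x ∈ ⟨ S ⟩
    unit : ε ∈ ⟨ S ⟩
    mul  : ∀ {x y} → x ∈ ⟨ S ⟩ → y ∈ ⟨ S ⟩ → (x ∙ y) ∈ ⟨ S ⟩
    inv  : ∀ {x} → x ∈ ⟨ S ⟩ → (x ⁻¹) ∈ ⟨ S ⟩
    resp : ∀ {x y} → x ≈ y → x ∈ ⟨ S ⟩ → y ∈ ⟨ S ⟩

  [_,_] : Carrier → Carrier → Carrier
  [ x , y ] = x ⁻¹ ∙ y ⁻¹ ∙ x ∙ y

  -- lower central series of H:  lcs H 0 = γ₁(H) = H,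
  -- lcs H (suc i) = γ_{i+2}(H) = [γ_{i+1}(H), H]
  lcs : Pred Carrier L → ℕ → Pred Carrier L
  lcs H zero    = H
  lcs H (suc i) = ⟨ (λ z → Σ Carrier λ x → Σ Carrier λ y →
                      x ∈ lcs H i × y ∈ H × z ≈ [ x , y ]) ⟩

  IsNilpotent : Pred Carrier L → Set L
  IsNilpotent H = Σ ℕ λ k → ∀ {z} → z ∈ lcs H k → z ≈ ε

  InDefNormalNilpotent : Pred Carrier L
  InDefNormalNilpotent x =
    Σ ℕ λ m → Σ (Formula (suc m)) λ φ → Σ (Vector Carrier m) λ a →
      IsSubgroup (defSet φ a) × IsNormal (defSet φ a) ×
      IsNilpotent (defSet φ a) × x ∈ defSet φ a

  dF : Pred Carrier L
  dF = ⟨ InDefNormalNilpotent ⟩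

module Submission where

-- If dF(G) = φ(G, ā) is a nilpotent subgroup, say with γ_{k+1}(dF(G)) = 1,
-- then dF(G) is defined without parameters by
--
--   ψ(x)  :=  ∃ȳ ( φ(x, ȳ)  ∧  φ(G, ȳ) is a normal subgroup of G
--                              with all k-fold commutators trivial ).
--
-- Every instance φ(G, b̄) admitted by ψ is a definable normal nilpotent
-- subgroup, hence lies in dF(G); conversely ā itself is admitted (dF(G) is
-- normal), so dF(G) = φ(G, ā) ⊆ ψ(G).  The only non-syntactic ingredient is
-- that "γ_{k+1}(H) = 1" is first-order: it holds iff every iterated
-- commutator [[x, h₁], …, h_k] of elements of H vanishes (Killed H k).

open import Defs
open import Level using (Level; Lift; lift; lower)
open import Data.Nat using (ℕ; zero; suc; _+_)
open import Data.Nat.Properties using (+-suc; +-identityʳ)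
open import Data.Fin as Fin using (Fin; _↑ˡ_; _↑ʳ_)
open import Data.Bool as Bool using (Bool; true; false; not)
open import Data.Product using (Σ; _×_; _,_; proj₁; proj₂)
open import Data.Product.Properties using (≡-dec)
open import Data.Product.Function.NonDependent.Propositional using (_×-⇔_)
open import Data.Sum.Function.Propositional using (_⊎-⇔_)
open import Data.List using (List; foldr) renaming (_∷_ to _∷ₗ_; [] to []ₗ)
open import Data.Vec.Functional using (Vector; _∷_; []; tail)
open import Relation.Nullary using (yes; no)
open import Relation.Unary using (Pred; _∈_; _⊆_)
open import Relation.Binary.Definitions using (DecidableEquality)
open import Relation.Binary.PropositionalEquality as ≡ using (_≡_)
open import Algebra.Bundles using (Group)
open import Function.Bundles using (_⇔_; mk⇔; Equivalence)
open import Function.Properties.Equivalence using () renaming (refl to ⇔-refl; trans to ⇔-trans)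
open import Function.Related.TypeIsomorphisms using (→-cong-⇔)

open Equivalence using (to; from)

private
  variable
    a b c ℓ : Level
    k n : ℕ

Π-⇔ : {A : Set a} {B : A → Set b} {C : A → Set c} →
      (∀ x → B x ⇔ C x) → ((x : A) → B x) ⇔ ((x : A) → C x)
Π-⇔ e = mk⇔ (λ f x → to (e x) (f x)) (λ f x → from (e x) (f x))

Πⁱ-⇔ : {A : Set a} {B : A → Set b} {C : A → Set c} →
       (∀ x → B x ⇔ C x) → ((x : A) → B x) ⇔ (∀ {x} → C x)
Πⁱ-⇔ e = mk⇔ (λ f {x} → to (e x) (f x)) (λ f x → from (e x) f)

Σ-⇔ : {A : Set a} {B : A → Set b} {C : A → Set c} →
      (∀ x → B x ⇔ C x) → Σ A B ⇔ Σ A C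
Σ-⇔ e = mk⇔ (λ (x , p) → x , to (e x) p) (λ (x , p) → x , from (e x) p)

Lift-⇔ : {A : Set a} → Lift ℓ A ⇔ A
Lift-⇔ = mk⇔ lower lift

-- A group identity holds in every group as soon as both sides have the same
-- (freely reduced) word; this is how the commutator identities below are proved.

data Expr (n : ℕ) : Set where
  atom : Fin n → Expr n
  ε′   : Expr n
  _∙′_ : Expr n → Expr n → Expr n
  _⁻¹′ : Expr n → Expr n

infixl 7 _∙′_
infix 8 _⁻¹′

e₀ : Expr (suc n)
e₀ = atom Fin.zero

e₁ : Expr (suc (suc n))
e₁ = atom (Fin.suc Fin.zero)

e₂ : Expr (suc (suc (suc n)))
e₂ = atom (Fin.suc (Fin.suc Fin.zero))

comm′ : Expr n → Expr n → Expr n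
comm′ x y = x ⁻¹′ ∙′ y ⁻¹′ ∙′ x ∙′ y

-- A letter is a generator with an exponent sign (true for +1, false for -1).
Letter : ℕ → Set
Letter n = Fin n × Bool

Word : ℕ → Set
Word n = List (Letter n)

flip-letter : Letter n → Letter n
flip-letter (i , s) = i , not s

_≟ₗ_ : DecidableEquality (Letter n)
_≟ₗ_ = ≡-dec Fin._≟_ Bool._≟_

cons : Letter n → Word n → Word n
cons l []ₗ = l ∷ₗ []ₗ
cons l (l′ ∷ₗ w) with l′ ≟ₗ flip-letter l
... | yes _ = w
... | no _  = l ∷ₗ l′ ∷ₗ w

append : Word n → Word n → Word n
append u w = foldr cons w u

invert : Word n → Word n
invert []ₗ      = []ₗ
invert (l ∷ₗ w) = append (invert w) (flip-letter l ∷ₗ []ₗ)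

normalise : Expr n → Word n
normalise (atom i) = (i , true) ∷ₗ []ₗ
normalise ε′       = []ₗ
normalise (x ∙′ y) = append (normalise x) (normalise y)
normalise (x ⁻¹′)  = invert (normalise x)

module GroupSolver (G : Group c ℓ) where
  open Group G
  open import Algebra.Properties.Group G
    using (\\-leftDividesˡ; \\-leftDividesʳ; ⁻¹-involutive; ε⁻¹≈ε; ⁻¹-anti-homo-∙)
  open import Relation.Binary.Reasoning.Setoid setoid

  ⟦_⟧ₑ : Expr n → Vector Carrier n → Carrier
  ⟦ atom i ⟧ₑ ρ = ρ i
  ⟦ ε′ ⟧ₑ     ρ = ε
  ⟦ x ∙′ y ⟧ₑ ρ = ⟦ x ⟧ₑ ρ ∙ ⟦ y ⟧ₑ ρ
  ⟦ x ⁻¹′ ⟧ₑ  ρ = ⟦ x ⟧ₑ ρ ⁻¹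

  module _ (ρ : Vector Carrier n) where

    ⟦_⟧ₗ : Letter n → Carrier
    ⟦ i , true ⟧ₗ  = ρ i
    ⟦ i , false ⟧ₗ = ρ i ⁻¹

    ⟦_⟧w : Word n → Carrier
    ⟦ []ₗ ⟧w    = ε
    ⟦ l ∷ₗ w ⟧w = ⟦ l ⟧ₗ ∙ ⟦ w ⟧w

    flip-sound : ∀ l → ⟦ flip-letter l ⟧ₗ ≈ ⟦ l ⟧ₗ ⁻¹
    flip-sound (i , true)  = refl
    flip-sound (i , false) = sym (⁻¹-involutive (ρ i))

    cancel : ∀ l x → ⟦ l ⟧ₗ ∙ (⟦ flip-letter l ⟧ₗ ∙ x) ≈ x
    cancel (i , true)  x = \\-leftDividesˡ (ρ i) x
    cancel (i , false) x = \\-leftDividesʳ (ρ i) x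

    cons-sound : ∀ l w → ⟦ cons l w ⟧w ≈ ⟦ l ⟧ₗ ∙ ⟦ w ⟧w
    cons-sound l []ₗ       = refl
    cons-sound l (l′ ∷ₗ w) with l′ ≟ₗ flip-letter l
    ... | yes ≡.refl = sym (cancel l ⟦ w ⟧w)
    ... | no _       = refl

    append-sound : ∀ u w → ⟦ append u w ⟧w ≈ ⟦ u ⟧w ∙ ⟦ w ⟧w
    append-sound []ₗ      w = sym (identityˡ _)
    append-sound (l ∷ₗ u) w = begin
      ⟦ cons l (append u w) ⟧w    ≈⟨ cons-sound l (append u w) ⟩
      ⟦ l ⟧ₗ ∙ ⟦ append u w ⟧w    ≈⟨ ∙-congˡ (append-sound u w) ⟩
      ⟦ l ⟧ₗ ∙ (⟦ u ⟧w ∙ ⟦ w ⟧w)  ≈⟨ assoc _ _ _ ⟨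
      ⟦ l ⟧ₗ ∙ ⟦ u ⟧w ∙ ⟦ w ⟧w    ∎

    invert-sound : ∀ w → ⟦ invert w ⟧w ≈ ⟦ w ⟧w ⁻¹
    invert-sound []ₗ      = sym ε⁻¹≈ε
    invert-sound (l ∷ₗ w) = begin
      ⟦ append (invert w) (flip-letter l ∷ₗ []ₗ) ⟧w  ≈⟨ append-sound (invert w) _ ⟩
      ⟦ invert w ⟧w ∙ (⟦ flip-letter l ⟧ₗ ∙ ε)     ≈⟨ ∙-congʳ (invert-sound w) ⟩
      ⟦ w ⟧w ⁻¹ ∙ (⟦ flip-letter l ⟧ₗ ∙ ε)         ≈⟨ ∙-congˡ (identityʳ _) ⟩
      ⟦ w ⟧w ⁻¹ ∙ ⟦ flip-letter l ⟧ₗ               ≈⟨ ∙-congˡ (flip-sound l) ⟩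
      ⟦ w ⟧w ⁻¹ ∙ ⟦ l ⟧ₗ ⁻¹                        ≈⟨ ⁻¹-anti-homo-∙ _ _ ⟨
      (⟦ l ⟧ₗ ∙ ⟦ w ⟧w) ⁻¹                         ∎

    normalise-sound : ∀ x → ⟦ x ⟧ₑ ρ ≈ ⟦ normalise x ⟧w
    normalise-sound (atom i) = sym (identityʳ (ρ i))
    normalise-sound ε′       = refl
    normalise-sound (x ∙′ y) =
      trans (∙-cong (normalise-sound x) (normalise-sound y))
            (sym (append-sound (normalise x) (normalise y)))
    normalise-sound (x ⁻¹′)  =
      trans (⁻¹-cong (normalise-sound x)) (sym (invert-sound (normalise x)))

  prove : (x y : Expr n) → normalise x ≡ normalise y → ∀ ρ → ⟦ x ⟧ₑ ρ ≈ ⟦ y ⟧ₑ ρ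
  prove x y eq ρ = begin
    ⟦ x ⟧ₑ ρ                ≈⟨ normalise-sound ρ x ⟩
    ⟦_⟧w ρ (normalise x)    ≡⟨ ≡.cong (⟦_⟧w ρ) eq ⟩
    ⟦_⟧w ρ (normalise y)    ≈⟨ normalise-sound ρ y ⟨
    ⟦ y ⟧ₑ ρ                ∎

module Commutators (G : Group c ℓ) where
  open Group G
  open GroupTheory G using ([_,_])
  open GroupSolver G using (prove)

  conj-ε : ∀ g → g ∙ ε ∙ g ⁻¹ ≈ ε
  conj-ε g = prove {1} (e₀ ∙′ ε′ ∙′ e₀ ⁻¹′) ε′ ≡.refl (g ∷ [])

  conj-∙ : ∀ g x y → g ∙ (x ∙ y) ∙ g ⁻¹ ≈ (g ∙ x ∙ g ⁻¹) ∙ (g ∙ y ∙ g ⁻¹)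
  conj-∙ g x y = prove {3} (e₀ ∙′ (e₁ ∙′ e₂) ∙′ e₀ ⁻¹′)
    ((e₀ ∙′ e₁ ∙′ e₀ ⁻¹′) ∙′ (e₀ ∙′ e₂ ∙′ e₀ ⁻¹′)) ≡.refl (g ∷ x ∷ y ∷ [])

  conj-⁻¹ : ∀ g x → g ∙ x ⁻¹ ∙ g ⁻¹ ≈ (g ∙ x ∙ g ⁻¹) ⁻¹
  conj-⁻¹ g x = prove {2} (e₀ ∙′ e₁ ⁻¹′ ∙′ e₀ ⁻¹′) ((e₀ ∙′ e₁ ∙′ e₀ ⁻¹′) ⁻¹′)
    ≡.refl (g ∷ x ∷ [])

  comm-εˡ : ∀ h → [ ε , h ] ≈ ε
  comm-εˡ h = prove {1} (comm′ ε′ e₀) ε′ ≡.refl (h ∷ [])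

  comm-conjˡ : ∀ g x h → [ g ∙ x ∙ g ⁻¹ , h ] ≈ g ∙ [ x , g ⁻¹ ∙ h ∙ g ] ∙ g ⁻¹
  comm-conjˡ g x h = prove {3} (comm′ (e₀ ∙′ e₁ ∙′ e₀ ⁻¹′) e₂)
    (e₀ ∙′ comm′ e₁ (e₀ ⁻¹′ ∙′ e₂ ∙′ e₀) ∙′ e₀ ⁻¹′) ≡.refl (g ∷ x ∷ h ∷ [])

  comm-∙ˡ : ∀ x y h → [ x ∙ y , h ] ≈ (y ⁻¹ ∙ [ x , h ] ∙ y ⁻¹ ⁻¹) ∙ [ y , h ]
  comm-∙ˡ x y h = prove {3} (comm′ (e₀ ∙′ e₁) e₂)
    ((e₁ ⁻¹′ ∙′ comm′ e₀ e₂ ∙′ e₁ ⁻¹′ ⁻¹′) ∙′ comm′ e₁ e₂) ≡.refl (x ∷ y ∷ h ∷ [])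

  comm-⁻¹ˡ : ∀ x h → [ x ⁻¹ , h ] ≈ x ∙ [ x , h ] ⁻¹ ∙ x ⁻¹
  comm-⁻¹ˡ x h = prove {2} (comm′ (e₀ ⁻¹′) e₁) (e₀ ∙′ comm′ e₀ e₁ ⁻¹′ ∙′ e₀ ⁻¹′)
    ≡.refl (x ∷ h ∷ [])

  comm-congˡ : ∀ {x y} h → x ≈ y → [ x , h ] ≈ [ y , h ]
  comm-congˡ h x≈y = ∙-congʳ (∙-cong (∙-congʳ (⁻¹-cong x≈y)) x≈y)

module Subgroups (G : Group c ℓ) where
  open Group G
  open GroupTheory G
  open Commutators G

  ⟨⟩-least : ∀ {S T} → IsSubgroup T → S ⊆ T → ⟨ S ⟩ ⊆ T
  ⟨⟩-least {S} {T} T-sub S⊆T = least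
    where
    open IsSubgroup T-sub renaming (resp to T-resp)
    least : ⟨ S ⟩ ⊆ T
    least (base x∈S)  = S⊆T x∈S
    least unit        = ε∈
    least (mul p q)   = ∙-closed (least p) (least q)
    least (inv p)     = ⁻¹-closed (least p)
    least (resp eq p) = T-resp eq (least p)

  -- dF(G) is normal: its generators form a conjugation-invariant set.
  dF-normal : IsNormal dF
  dF-normal g (base (m , φ , a , sub , nor , nil , x∈)) =
    base (m , φ , a , sub , nor , nil , nor g x∈)
  dF-normal g unit              = resp (sym (conj-ε g)) unit
  dF-normal g (mul {x} {y} p q) = resp (sym (conj-∙ g x y)) (mul (dF-normal g p) (dF-normal g q))
  dF-normal g (inv {x} p)       = resp (sym (conj-⁻¹ g x)) (inv (dF-normal g p))
  dF-normal g (resp eq p)       = resp (∙-congʳ (∙-congˡ eq)) (dF-normal g p)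

  IsSubgroup⇔closure : ∀ S → ((∀ {x y} → x ≈ y → x ∈ S → y ∈ S) × ε ∈ S ×
                              (∀ {x y} → x ∈ S → y ∈ S → (x ∙ y) ∈ S) ×
                              (∀ {x} → x ∈ S → (x ⁻¹) ∈ S)) ⇔ IsSubgroup S
  IsSubgroup⇔closure S = mk⇔
    (λ (r , e , m , i) → record { resp = r ; ε∈ = e ; ∙-closed = m ; ⁻¹-closed = i })
    (λ S-sub → (λ {x y} → IsSubgroup.resp S-sub) , IsSubgroup.ε∈ S-sub ,
               (λ {x y} → IsSubgroup.∙-closed S-sub) , (λ {x} → IsSubgroup.⁻¹-closed S-sub))

  module _ {H : Pred Carrier L} (H-sub : IsSubgroup H) where
    open IsSubgroup H-sub using () renaming
      (resp to H-resp; ∙-closed to H-∙; ⁻¹-closed to H-⁻¹)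

    conj∈ : ∀ {g x} → g ∈ H → x ∈ H → (g ∙ x ∙ g ⁻¹) ∈ H
    conj∈ g∈ x∈ = H-∙ (H-∙ g∈ x∈) (H-⁻¹ g∈)

    conj⁻¹∈ : ∀ {g x} → g ∈ H → x ∈ H → (g ⁻¹ ∙ x ∙ g) ∈ H
    conj⁻¹∈ g∈ x∈ = H-∙ (H-∙ (H-⁻¹ g∈) x∈) g∈

    comm∈ : ∀ {x y} → x ∈ H → y ∈ H → [ x , y ] ∈ H
    comm∈ x∈ y∈ = H-∙ (H-∙ (H-∙ (H-⁻¹ x∈) (H-⁻¹ y∈)) x∈) y∈

    lcs⊆ : ∀ i → lcs H i ⊆ H
    lcs⊆ zero    x∈ = x∈
    lcs⊆ (suc i) x∈ = ⟨⟩-least H-sub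
      (λ (x , y , x∈ , y∈ , z≈) → H-resp (sym z≈) (comm∈ (lcs⊆ i x∈) y∈)) x∈

-- Killed H j x says that x ∈ H (for j > 0) and every
-- commutator [[x, h₁], …, h_j] with hᵢ ∈ H is trivial.  Then
-- γ_{k+1}(H) = 1  iff  H ⊆ Killed H k, a condition that is first-order
-- (see KilledF below), while γ_{k+1}(H), a generated subgroup, has no
-- evident first-order definition.
module Nilpotency (G : Group c ℓ) where
  open Group G
  open GroupTheory G
  open Commutators G
  open Subgroups G
  open import Algebra.Properties.Group G using (ε⁻¹≈ε)

  Killed : Pred Carrier L → ℕ → Pred Carrier L
  Killed H zero    x = Lift c (x ≈ ε)
  Killed H (suc j) x = x ∈ H × ((h : Carrier) → h ∈ H → Killed H j [ x , h ])

  Trivial : Pred Carrier L → Set L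
  Trivial S = ∀ {z} → z ∈ S → z ≈ ε

  record NormalisedBy (H S : Pred Carrier L) : Set L where
    field
      isSubgroup  : IsSubgroup S
      conj-closed : ∀ {g x} → g ∈ H → x ∈ S → (g ∙ x ∙ g ⁻¹) ∈ S
    open IsSubgroup isSubgroup public

  -- Each Killed H j is a subgroup normalised by H; the commutator identities
  -- reduce each closure property at level j+1 to closure properties at level j.
  killed-normalised : ∀ {H} → IsSubgroup H → ∀ j → NormalisedBy H (Killed H j)
  killed-normalised H-sub zero = record
    { isSubgroup = record
      { resp      = λ x≈y x≈ε → lift (trans (sym x≈y) (lower x≈ε))
      ; ε∈        = lift refl
      ; ∙-closed  = λ x≈ε y≈ε →
          lift (trans (∙-cong (lower x≈ε) (lower y≈ε)) (identityˡ ε))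
      ; ⁻¹-closed = λ x≈ε → lift (trans (⁻¹-cong (lower x≈ε)) ε⁻¹≈ε)
      }
    ; conj-closed = λ {g} _ x≈ε →
        lift (trans (∙-congʳ (∙-congˡ (lower x≈ε))) (conj-ε g))
    }
  killed-normalised H-sub (suc j) = record
    { isSubgroup = record
      { resp      = λ x≈y (x∈ , kx) → H.resp x≈y x∈ , λ h h∈ →
          K.resp (comm-congˡ h x≈y) (kx h h∈)
      ; ε∈        = H.ε∈ , λ h _ → K.resp (sym (comm-εˡ h)) K.ε∈
      ; ∙-closed  = λ {x} {y} (x∈ , kx) (y∈ , ky) → H.∙-closed x∈ y∈ , λ h h∈ →
          K.resp (sym (comm-∙ˡ x y h))
            (K.∙-closed (K.conj-closed (H.⁻¹-closed y∈) (kx h h∈)) (ky h h∈))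
      ; ⁻¹-closed = λ {x} (x∈ , kx) → H.⁻¹-closed x∈ , λ h h∈ →
          K.resp (sym (comm-⁻¹ˡ x h)) (K.conj-closed x∈ (K.⁻¹-closed (kx h h∈)))
      }
    ; conj-closed = λ {g} {x} g∈ (x∈ , kx) → conj∈ H-sub g∈ x∈ , λ h h∈ →
        K.resp (sym (comm-conjˡ g x h))
          (K.conj-closed g∈ (kx (g ⁻¹ ∙ h ∙ g) (conj⁻¹∈ H-sub g∈ h∈)))
    }
    where
    module H = IsSubgroup H-sub
    module K = NormalisedBy (killed-normalised H-sub j)

  module _ {H : Pred Carrier L} (H-sub : IsSubgroup H) where

    -- γ_{i+j+1}(H) = 1  implies  γ_{i+1}(H) ⊆ Killed H j,
    -- since commutators of γ_{i+1}(H) with H generate γ_{i+2}(H).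
    lcs-trivial⇒killed : ∀ j i → Trivial (lcs H (i + j)) → lcs H i ⊆ Killed H j
    lcs-trivial⇒killed zero i triv x∈ =
      lift (≡.subst (λ n → Trivial (lcs H n)) (+-identityʳ i) triv x∈)
    lcs-trivial⇒killed (suc j) i triv {x} x∈ = lcs⊆ H-sub i x∈ , λ h h∈ →
      lcs-trivial⇒killed j (suc i) (≡.subst (λ n → Trivial (lcs H n)) (+-suc i j) triv)
        (base (x , h , x∈ , h∈ , refl))

    -- H ⊆ Killed H (i + j)  implies  γ_{i+1}(H) ⊆ Killed H j, by induction on i:
    -- Killed H j is a subgroup containing the generators [x, h] of γ_{i+2}(H).
    killed⇒lcs-killed : ∀ i j → H ⊆ Killed H (i + j) → lcs H i ⊆ Killed H j
    killed⇒lcs-killed zero    j H⊆ = H⊆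
    killed⇒lcs-killed (suc i) j H⊆ = ⟨⟩-least K.isSubgroup
      λ (x , h , x∈ , h∈ , z≈) →
        K.resp (sym z≈) (proj₂ (killed⇒lcs-killed i (suc j) H⊆′ x∈) h h∈)
      where
      module K = NormalisedBy (killed-normalised H-sub j)
      H⊆′ : H ⊆ Killed H (i + suc j)
      H⊆′ = ≡.subst (λ n → H ⊆ Killed H n) (≡.sym (+-suc i j)) H⊆

    nilpotent⇒killed : (nil : IsNilpotent H) → H ⊆ Killed H (proj₁ nil)
    nilpotent⇒killed (k , triv) = lcs-trivial⇒killed k zero triv

    killed⇒nilpotent : ∀ k → H ⊆ Killed H k → IsNilpotent H
    killed⇒nilpotent k H⊆ = k , λ z∈ → lower (killed⇒lcs-killed k zero H⊆′ z∈)
      where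
      H⊆′ : H ⊆ Killed H (k + zero)
      H⊆′ = ≡.subst (λ n → H ⊆ Killed H n) (≡.sym (+-identityʳ k)) H⊆

substT : (Fin n → Term k) → Term n → Term k
substT σ (var i) = σ i
substT σ one     = one
substT σ (s · t) = substT σ s · substT σ t
substT σ (inv t) = inv (substT σ t)

wkT : Term n → Term (suc n)
wkT = substT (λ i → var (Fin.suc i))

liftS : (Fin n → Term k) → Fin (suc n) → Term (suc k)
liftS σ Fin.zero    = var Fin.zero
liftS σ (Fin.suc i) = wkT (σ i)

substF : (Fin n → Term k) → Formula n → Formula k
substF σ (s ≐ t) = substT σ s ≐ substT σ t
substF σ ⊥̇       = ⊥̇
substF σ (φ ∧̇ ψ) = substF σ φ ∧̇ substF σ ψ
substF σ (φ ∨̇ ψ) = substF σ φ ∨̇ substF σ ψ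
substF σ (φ ⇒̇ ψ) = substF σ φ ⇒̇ substF σ ψ
substF σ (¬̇ φ)   = ¬̇ substF σ φ
substF σ (∀̇ φ)   = ∀̇ (substF (liftS σ) φ)
substF σ (∃̇ φ)   = ∃̇ (substF (liftS σ) φ)

existsF : ∀ m → Formula (m + n) → Formula n
existsF zero    θ = θ
existsF (suc m) θ = existsF m (∃̇ θ)

-- The environment b ++ ρ, unfolded in the order in which existsF binds.
prepend : {A : Set a} {m : ℕ} → Vector A m → Vector A n → Vector A (m + n)
prepend {m = zero}  b ρ = ρ
prepend {m = suc m} b ρ = b Fin.zero ∷ prepend (tail b) ρ

prepend-↑ˡ : {A : Set a} {m : ℕ} (b : Vector A m) (ρ : Vector A n) (i : Fin m) →
             prepend b ρ (i ↑ˡ n) ≡ b i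
prepend-↑ˡ {m = suc m} b ρ Fin.zero    = ≡.refl
prepend-↑ˡ {m = suc m} b ρ (Fin.suc i) = prepend-↑ˡ (tail b) ρ i

prepend-↑ʳ : {A : Set a} {m : ℕ} (b : Vector A m) (ρ : Vector A n) (j : Fin n) →
             prepend b ρ (m ↑ʳ j) ≡ ρ j
prepend-↑ʳ {m = zero}  b ρ j = ≡.refl
prepend-↑ʳ {m = suc m} b ρ j = prepend-↑ʳ (tail b) ρ j

module Substitution (G : Group c ℓ) where
  open Group G using (Carrier; _≈_; _∙_; _⁻¹)
  open GroupTheory G

  module _ {n k} {σ : Fin n → Term k} {ρ : Vector Carrier k} {ρ′ : Vector Carrier n} where

    substT-sound : (∀ i → ρ′ i ≡ ⟦ σ i ⟧ₜ ρ) → ∀ t → ⟦ substT σ t ⟧ₜ ρ ≡ ⟦ t ⟧ₜ ρ′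
    substT-sound σ≗ (var i) = ≡.sym (σ≗ i)
    substT-sound σ≗ one     = ≡.refl
    substT-sound σ≗ (s · t) = ≡.cong₂ _∙_ (substT-sound σ≗ s) (substT-sound σ≗ t)
    substT-sound σ≗ (inv t) = ≡.cong _⁻¹ (substT-sound σ≗ t)

  wkT-sound : ∀ {n} (ρ : Vector Carrier n) x t → ⟦ wkT t ⟧ₜ (x ∷ ρ) ≡ ⟦ t ⟧ₜ ρ
  wkT-sound ρ x = substT-sound (λ _ → ≡.refl)

  liftS-sound : ∀ {n k} {σ : Fin n → Term k} {ρ ρ′} → (∀ i → ρ′ i ≡ ⟦ σ i ⟧ₜ ρ) →
                ∀ x i → (x ∷ ρ′) i ≡ ⟦ liftS σ i ⟧ₜ (x ∷ ρ)
  liftS-sound σ≗ x Fin.zero                = ≡.refl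
  liftS-sound {σ = σ} {ρ} σ≗ x (Fin.suc i) = ≡.trans (σ≗ i) (≡.sym (wkT-sound ρ x (σ i)))

  substF-sound : ∀ {n k} {σ : Fin n → Term k} {ρ ρ′} → (∀ i → ρ′ i ≡ ⟦ σ i ⟧ₜ ρ) →
                 ∀ φ → ρ ⊨ substF σ φ ⇔ ρ′ ⊨ φ
  substF-sound {ρ′ = ρ′} σ≗ (s ≐ t) =
    ≡.subst₂ (λ u v → Lift c (u ≈ v) ⇔ ρ′ ⊨ (s ≐ t))
      (≡.sym (substT-sound σ≗ s)) (≡.sym (substT-sound σ≗ t)) ⇔-refl
  substF-sound σ≗ ⊥̇       = ⇔-refl
  substF-sound σ≗ (φ ∧̇ ψ) = substF-sound σ≗ φ ×-⇔ substF-sound σ≗ ψ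
  substF-sound σ≗ (φ ∨̇ ψ) = substF-sound σ≗ φ ⊎-⇔ substF-sound σ≗ ψ
  substF-sound σ≗ (φ ⇒̇ ψ) = →-cong-⇔ (substF-sound σ≗ φ) (substF-sound σ≗ ψ)
  substF-sound σ≗ (¬̇ φ)   = →-cong-⇔ (substF-sound σ≗ φ) ⇔-refl
  substF-sound σ≗ (∀̇ φ)   = Π-⇔ λ x → substF-sound (liftS-sound σ≗ x) φ
  substF-sound σ≗ (∃̇ φ)   = Σ-⇔ λ x → substF-sound (liftS-sound σ≗ x) φ

  existsF-sound : ∀ {n} m (θ : Formula (m + n)) (ρ : Vector Carrier n) →
                  ρ ⊨ existsF m θ ⇔ Σ (Vector Carrier m) λ b → prepend b ρ ⊨ θ
  existsF-sound zero    θ ρ = mk⇔ (λ p → (λ ()) , p) proj₂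
  existsF-sound (suc m) θ ρ = ⇔-trans (existsF-sound m (∃̇ θ) ρ)
    (mk⇔ (λ (b , x , p) → x ∷ b , p) (λ (b , p) → tail b , b Fin.zero , p))

module Formulas {m : ℕ} (φ : Formula (suc m)) where

  x₀ : Term (suc n)
  x₀ = var Fin.zero

  x₁ : Term (suc (suc n))
  x₁ = var (Fin.suc Fin.zero)

  weaken : (Fin m → Term n) → Fin m → Term (suc n)
  weaken ys i = wkT (ys i)

  Mem : Term n → (Fin m → Term n) → Formula n
  Mem t ys = substF (t ∷ ys) φ

  commT : Term n → Term n → Term n
  commT u h = ((inv u · inv h) · u) · h

  KilledF : ℕ → Term n → (Fin m → Term n) → Formula n
  KilledF zero    u ys = u ≐ one
  KilledF (suc j) u ys =
    Mem u ys ∧̇ ∀̇ (Mem x₀ (weaken ys) ⇒̇ KilledF j (commT (wkT u) x₀) (weaken ys))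

  RespF MulF InvF : (Fin m → Term n) → Formula n
  RespF ys = ∀̇ (∀̇ ((x₁ ≐ x₀) ⇒̇
                 (Mem x₁ (weaken (weaken ys)) ⇒̇ Mem x₀ (weaken (weaken ys)))))
  MulF ys = ∀̇ (∀̇ (Mem x₁ (weaken (weaken ys)) ⇒̇
                 (Mem x₀ (weaken (weaken ys)) ⇒̇ Mem (x₁ · x₀) (weaken (weaken ys)))))
  InvF ys = ∀̇ (Mem x₀ (weaken ys) ⇒̇ Mem (inv x₀) (weaken ys))

  -- φ(G, ys) is a subgroup, listing the clauses in the order of IsSubgroup
  SubgroupF : (Fin m → Term n) → Formula n
  SubgroupF ys = RespF ys ∧̇ (Mem one ys ∧̇ (MulF ys ∧̇ InvF ys))

  NormalF : (Fin m → Term n) → Formula n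
  NormalF ys = ∀̇ (∀̇ (Mem x₀ ys₂ ⇒̇ Mem ((x₁ · x₀) · inv x₁) ys₂))
    where
    ys₂ = weaken (weaken ys)

  ClassF : ℕ → (Fin m → Term n) → Formula n
  ClassF k ys = ∀̇ (Mem x₀ (weaken ys) ⇒̇ KilledF k x₀ (weaken ys))

  params : Fin m → Term (m + 1)
  params i = var (i ↑ˡ 1)

  ψ : ℕ → Formula 1
  ψ k = existsF m (Mem (var (m ↑ʳ Fin.zero)) params ∧̇
                   (SubgroupF params ∧̇ (NormalF params ∧̇ ClassF k params)))

module FormulaSemantics (G : Group c ℓ) {m : ℕ} (φ : Formula (suc m)) where
  open Group G
  open GroupTheory G
  open Subgroups G using (IsSubgroup⇔closure)
  open Nilpotency G
  open Substitution G
  open Formulas φ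

  module _ (b : Vector Carrier m) where

    S : Pred Carrier L
    S = defSet φ b

    record Denotes (ys : Fin m → Term n) (ρ : Vector Carrier n) : Set c where
      constructor denotes
      field value : ∀ i → ⟦ ys i ⟧ₜ ρ ≡ b i

    denotes-weaken : ∀ {n ys} {ρ : Vector Carrier n} x →
                     Denotes ys ρ → Denotes (weaken ys) (x ∷ ρ)
    denotes-weaken {ys = ys} {ρ} x (denotes ys≗) =
      denotes λ i → ≡.trans (wkT-sound ρ x (ys i)) (ys≗ i)

    Mem-sound : ∀ {n ys} {ρ : Vector Carrier n} → Denotes ys ρ →
                ∀ t → ρ ⊨ Mem t ys ⇔ S (⟦ t ⟧ₜ ρ)
    Mem-sound {ys = ys} {ρ} (denotes ys≗) t = substF-sound σ≗ φ
      where
      σ≗ : ∀ i → (⟦ t ⟧ₜ ρ ∷ b) i ≡ ⟦ (t ∷ ys) i ⟧ₜ ρ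
      σ≗ Fin.zero    = ≡.refl
      σ≗ (Fin.suc i) = ≡.sym (ys≗ i)

    Mem-sound¹ : ∀ {n ys} {ρ : Vector Carrier n} → Denotes ys ρ →
                 ∀ x t → (x ∷ ρ) ⊨ Mem t (weaken ys) ⇔ S (⟦ t ⟧ₜ (x ∷ ρ))
    Mem-sound¹ ys≗ x = Mem-sound (denotes-weaken x ys≗)

    Mem-sound² : ∀ {n ys} {ρ : Vector Carrier n} → Denotes ys ρ → ∀ x y t →
                 (y ∷ x ∷ ρ) ⊨ Mem t (weaken (weaken ys)) ⇔ S (⟦ t ⟧ₜ (y ∷ x ∷ ρ))
    Mem-sound² ys≗ x y = Mem-sound (denotes-weaken y (denotes-weaken x ys≗))

    KilledF-sound : ∀ j {n ys} {ρ : Vector Carrier n} → Denotes ys ρ →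
                    ∀ u → ρ ⊨ KilledF j u ys ⇔ Killed S j (⟦ u ⟧ₜ ρ)
    KilledF-sound zero    ys≗ u = ⇔-refl
    KilledF-sound (suc j) {ys = ys} {ρ} ys≗ u =
      Mem-sound ys≗ u ×-⇔ Π-⇔ λ h → →-cong-⇔ (Mem-sound¹ ys≗ h x₀) (commutator h)
      where
      -- the inner formula speaks about [⟦u⟧, h], as wkT u still denotes ⟦u⟧
      commutator : ∀ h → (h ∷ ρ) ⊨ KilledF j (commT (wkT u) x₀) (weaken ys) ⇔
                         Killed S j [ ⟦ u ⟧ₜ ρ , h ]
      commutator h =
        ≡.subst (λ y → (h ∷ ρ) ⊨ KilledF j (commT (wkT u) x₀) (weaken ys) ⇔
                       Killed S j [ y , h ])
          (wkT-sound ρ h u) (KilledF-sound j (denotes-weaken h ys≗) (commT (wkT u) x₀))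

    RespF-sound : ∀ {n ys} {ρ : Vector Carrier n} → Denotes ys ρ →
                  ρ ⊨ RespF ys ⇔ (∀ {x y} → x ≈ y → x ∈ S → y ∈ S)
    RespF-sound ys≗ = Πⁱ-⇔ λ x → Πⁱ-⇔ λ y →
      →-cong-⇔ Lift-⇔ (→-cong-⇔ (Mem-sound² ys≗ x y x₁) (Mem-sound² ys≗ x y x₀))

    MulF-sound : ∀ {n ys} {ρ : Vector Carrier n} → Denotes ys ρ →
                 ρ ⊨ MulF ys ⇔ (∀ {x y} → x ∈ S → y ∈ S → (x ∙ y) ∈ S)
    MulF-sound ys≗ = Πⁱ-⇔ λ x → Πⁱ-⇔ λ y →
      →-cong-⇔ (Mem-sound² ys≗ x y x₁)
        (→-cong-⇔ (Mem-sound² ys≗ x y x₀) (Mem-sound² ys≗ x y (x₁ · x₀)))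

    InvF-sound : ∀ {n ys} {ρ : Vector Carrier n} → Denotes ys ρ →
                 ρ ⊨ InvF ys ⇔ (∀ {x} → x ∈ S → (x ⁻¹) ∈ S)
    InvF-sound ys≗ = Πⁱ-⇔ λ x → →-cong-⇔ (Mem-sound¹ ys≗ x x₀) (Mem-sound¹ ys≗ x (inv x₀))

    SubgroupF-sound : ∀ {n ys} {ρ : Vector Carrier n} → Denotes ys ρ →
                      ρ ⊨ SubgroupF ys ⇔ IsSubgroup S
    SubgroupF-sound ys≗ = ⇔-trans
      (RespF-sound ys≗ ×-⇔ (Mem-sound ys≗ one ×-⇔ (MulF-sound ys≗ ×-⇔ InvF-sound ys≗)))
      (IsSubgroup⇔closure S)

    NormalF-sound : ∀ {n ys} {ρ : Vector Carrier n} → Denotes ys ρ →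
                    ρ ⊨ NormalF ys ⇔ IsNormal S
    NormalF-sound ys≗ = Π-⇔ λ g → Πⁱ-⇔ λ h →
      →-cong-⇔ (Mem-sound² ys≗ g h x₀) (Mem-sound² ys≗ g h ((x₁ · x₀) · inv x₁))

    ClassF-sound : ∀ k {n ys} {ρ : Vector Carrier n} → Denotes ys ρ →
                   ρ ⊨ ClassF k ys ⇔ S ⊆ Killed S k
    ClassF-sound k ys≗ = Πⁱ-⇔ λ h →
      →-cong-⇔ (Mem-sound¹ ys≗ h x₀) (KilledF-sound k (denotes-weaken h ys≗) x₀)

  InKilledInstance : ℕ → Pred Carrier L
  InKilledInstance k x = Σ (Vector Carrier m) λ b →
    x ∈ S b × IsSubgroup (S b) × IsNormal (S b) × S b ⊆ Killed (S b) k

  ψ-defines : ∀ k x → (x ∷ []) ⊨ ψ k ⇔ InKilledInstance k x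
  ψ-defines k x = ⇔-trans (existsF-sound m _ (x ∷ [])) (Σ-⇔ λ b →
    member b ×-⇔ (SubgroupF-sound b (params≗ b) ×-⇔
                 (NormalF-sound b (params≗ b) ×-⇔ ClassF-sound b k (params≗ b))))
    where
    params≗ : ∀ b → Denotes b params (prepend b (x ∷ []))
    params≗ b = denotes (prepend-↑ˡ b (x ∷ []))

    member : ∀ b → prepend b (x ∷ []) ⊨ Mem (var (m ↑ʳ Fin.zero)) params ⇔ S b x
    member b = ≡.subst (λ y → prepend b (x ∷ []) ⊨ Mem (var (m ↑ʳ Fin.zero)) params ⇔ S b y)
      (prepend-↑ʳ b (x ∷ []) Fin.zero) (Mem-sound b (params≗ b) (var (m ↑ʳ Fin.zero)))

open GroupTheory using (IsSubgroup; IsNilpotent; defSet; dF; _⊨_)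

lemma3p6 : ∀ {c ℓ : Level} (G : Group c ℓ) (m : ℕ) (φ : Formula (suc m))
    (a : Vector (Group.Carrier G) m) →
    IsSubgroup G (defSet G φ a) → IsNilpotent G (defSet G φ a) →
    (∀ x → dF G x ⇔ defSet G φ a x) →
    Σ (Formula 1) λ ψ → ∀ x → dF G x ⇔ _⊨_ G (x ∷ []) ψ
lemma3p6 G m φ a sub nil dF⇔φ = Formulas.ψ φ class , λ x →
    mk⇔ (λ x∈dF → from (ψ-defines class x) (a , to (dF⇔φ x) x∈dF , sub , normal , killed))
        (λ x∈ψ → admitted⊆dF (to (ψ-defines class x) x∈ψ))
  where
  open GroupTheory G using (IsNormal; ⟨_⟩)
  open Subgroups G using (dF-normal)
  open Nilpotency G using (Killed; nilpotent⇒killed; killed⇒nilpotent)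
  open FormulaSemantics G φ using (ψ-defines; InKilledInstance)

  class : ℕ
  class = proj₁ nil

  killed : defSet G φ a ⊆ Killed (defSet G φ a) class
  killed = nilpotent⇒killed sub nil

  normal : IsNormal (defSet G φ a)
  normal g h∈ = to (dF⇔φ _) (dF-normal g (from (dF⇔φ _) h∈))

  admitted⊆dF : ∀ {x} → InKilledInstance class x → dF G x
  admitted⊆dF (b , x∈ , sub′ , normal′ , killed′) =
    ⟨_⟩.base (m , φ , b , sub′ , normal′ , killed⇒nilpotent sub′ class killed′ , x∈)
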